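{- Let $G$ be a finite commutative group with $|G|=q$, and let $A_1,A_2\subset G$ be standard sets. Then \[ \overline\delta(A_1\cap A_2)\le q\,\overline\delta(A_1)\,\overline\delta(A_2). \]
   Context: $G$ is written additively. A set $A\subset G$ is a standard set if $A=-A$ and $0\in A$. For a standard set $A$, $\overline\Delta(A)=\max\{|B|:B\subset G,\ B-B\subset A\}$ and $\overline\delta(A)=1/\overline\Delta(A)$. -}

module Defs where

open import Data.Nat using (ℕ; zero; suc; _≤_)
open import Data.Integer using (+_)
open import Data.Fin using (Fin)
open import Data.Fin.Subset using (Subset; _∈_; ∣_∣)
open import Data.Product using (Σ; _×_)
open import Data.Rational using (ℚ; _/_; 0ℚ)
open import Relation.Binary.PropositionalEquality using (_≡_)
open import Algebra.Structures using (IsAbelianGroup)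

-- A finite commutative group of order q, with underlying set Fin q
-- (every finite commutative group of order q is isomorphic to one of these).
record FinAbGroup (q : ℕ) : Set where
  infixl 6 _+ᴳ_
  field
    _+ᴳ_ : Fin q → Fin q → Fin q
    0ᴳ : Fin q
    -ᴳ_ : Fin q → Fin q
    isAbelianGroup : IsAbelianGroup _≡_ _+ᴳ_ 0ᴳ -ᴳ_

  _-ᴳ_ : Fin q → Fin q → Fin q
  x -ᴳ y = x +ᴳ (-ᴳ y)

module _ {q : ℕ} (G : FinAbGroup q) where
  open FinAbGroup G

  -- A is a standard set: A = -A and 0 ∈ A.
  -- (Since negation is an involution, A = -A iff A is closed under negation.)
  IsStandard : Subset q → Set
  IsStandard A = (0ᴳ ∈ A) × (∀ x → x ∈ A → (-ᴳ x) ∈ A)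

  DiffIn : Subset q → Subset q → Set
  DiffIn B A = ∀ x y → x ∈ B → y ∈ B → (x -ᴳ y) ∈ A

  IsΔ : Subset q → ℕ → Set
  IsΔ A n = Σ (Subset q) (λ B → DiffIn B A × ∣ B ∣ ≡ n)
          × (∀ B → DiffIn B A → ∣ B ∣ ≤ n)

-- reciprocal 1/n as a rational (value at 0 is irrelevant: Δ̄(A) ≥ 1 for standard A)
recip : ℕ → ℚ
recip zero = 0ℚ
recip (suc n) = + 1 / suc n

-- If B₁ and B₂ are extremal for A₁ and A₂, then every set B₁ ∩ (x + B₂) has all its
-- differences in A₁ ∩ A₂, so has at most Δ̄(A₁ ∩ A₂) elements. Summing over the q
-- translates counts each pair (b₁, b₂) ∈ B₁ × B₂ exactly once (at x = b₁ − b₂), whence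
-- Δ̄(A₁) Δ̄(A₂) ≤ q Δ̄(A₁ ∩ A₂), which is the claim after taking reciprocals; all three
-- values are positive because {0} is admissible for any A containing 0.
module Submission where

open import Defs
open import Data.Nat using (ℕ)
open import Data.Integer using (+_)
open import Data.Fin.Subset using (Subset; _∩_)
open import Data.Rational using (_≤_; _*_; _/_)

open import Data.Bool using (Bool; true; false; _∧_)
open import Data.Fin using (Fin)
open import Data.Fin.Permutation using (permutation)
open import Data.Fin.Subset using (_∈_; ∣_∣; ⁅_⁆)
open import Data.Fin.Subset.Properties using (x∈p∩q⁺; x∈p∩q⁻; x∈⁅y⁆⇒x≡y; ∣⁅x⁆∣≡1)
import Data.Integer as ℤ
import Data.Integer.Properties as ℤ
open import Data.Integer.Tactic.RingSolver using (solve-∀)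
import Data.Nat as ℕ
import Data.Nat.Properties as ℕ
open import Data.Product using (_,_)
open import Data.Rational using (toℚᵘ)
import Data.Rational.Properties as ℚ
open import Data.Rational.Unnormalised as ℚᵘ using (mkℚᵘ; _≃_)
import Data.Rational.Unnormalised.Properties as ℚᵘ
open import Data.Vec using ([]; _∷_; lookup; tabulate)
open import Data.Vec.Properties using (lookup∘tabulate; []=⇒lookup; lookup⇒[]=)
open import Algebra.Bundles using (AbelianGroup)
open import Algebra.Structures using (IsAbelianGroup)
import Algebra.Properties.AbelianGroup as AbelianGroupProperties
open import Algebra.Properties.Semiring.Sum ℕ.+-*-semiring
  using (sum; sum-cong-≗; ∑-comm; ∑-permute; *-distribˡ-sum; *-distribʳ-sum)
open import Relation.Binary.PropositionalEquality

indicator : Bool → ℕ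
indicator true = 1
indicator false = 0

∣p∣≡∑indicator : ∀ {m} (p : Subset m) → ∣ p ∣ ≡ sum (λ i → indicator (lookup p i))
∣p∣≡∑indicator [] = refl
∣p∣≡∑indicator (true ∷ p) = cong ℕ.suc (∣p∣≡∑indicator p)
∣p∣≡∑indicator (false ∷ p) = ∣p∣≡∑indicator p

∣p∩q∣≡∑indicator* : ∀ {m} (p q : Subset m) →
  ∣ p ∩ q ∣ ≡ sum (λ i → indicator (lookup p i) ℕ.* indicator (lookup q i))
∣p∩q∣≡∑indicator* [] [] = refl
∣p∩q∣≡∑indicator* (true ∷ p) (true ∷ q) = cong ℕ.suc (∣p∩q∣≡∑indicator* p q)
∣p∩q∣≡∑indicator* (true ∷ p) (false ∷ q) = ∣p∩q∣≡∑indicator* p q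
∣p∩q∣≡∑indicator* (false ∷ p) (_ ∷ q) = ∣p∩q∣≡∑indicator* p q

sum-≤-* : ∀ {m} (f : Fin m → ℕ) c → (∀ i → f i ℕ.≤ c) → sum f ℕ.≤ m ℕ.* c
sum-≤-* {ℕ.zero} f c f≤c = ℕ.z≤n
sum-≤-* {ℕ.suc m} f c f≤c =
  ℕ.+-mono-≤ (f≤c Fin.zero) (sum-≤-* (λ i → f (Fin.suc i)) c (λ i → f≤c (Fin.suc i)))

recip-≤-scaled : ∀ q {a b m} → 1 ℕ.≤ a → 1 ℕ.≤ b → 1 ℕ.≤ m → a ℕ.* b ℕ.≤ q ℕ.* m →
  recip m ≤ ((+ q / 1) * recip a) * recip b
recip-≤-scaled q {ℕ.suc a} {ℕ.suc b} {ℕ.suc m} (ℕ.s≤s ℕ.z≤n) (ℕ.s≤s ℕ.z≤n) (ℕ.s≤s ℕ.z≤n) ab≤qm =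
  ℚ.toℚᵘ-cancel-≤ (ℚᵘ.≤-respˡ-≃ (ℚᵘ.≃-sym (ℚ.toℚᵘ-fromℚᵘ (mkℚᵘ (+ 1) m)))
                  (ℚᵘ.≤-respʳ-≃ (ℚᵘ.≃-sym rhs≃) (ℚᵘ.*≤* (subst₂ ℤ._≤_ lhs≡ rhs≡ (ℤ.+≤+ ab≤qm)))))
  where
  rhs≃ : toℚᵘ ((+ q / 1) * recip (ℕ.suc a) * recip (ℕ.suc b)) ≃
         mkℚᵘ (+ q) 0 ℚᵘ.* mkℚᵘ (+ 1) a ℚᵘ.* mkℚᵘ (+ 1) b
  rhs≃ = ℚᵘ.≃-trans (ℚ.toℚᵘ-homo-* ((+ q / 1) * recip (ℕ.suc a)) (recip (ℕ.suc b)))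
           (ℚᵘ.*-cong (ℚᵘ.≃-trans (ℚ.toℚᵘ-homo-* (+ q / 1) (recip (ℕ.suc a)))
             (ℚᵘ.*-cong (ℚ.toℚᵘ-fromℚᵘ (mkℚᵘ (+ q) 0)) (ℚ.toℚᵘ-fromℚᵘ (mkℚᵘ (+ 1) a))))
             (ℚ.toℚᵘ-fromℚᵘ (mkℚᵘ (+ 1) b)))
  lhs≡ : + (ℕ.suc a ℕ.* ℕ.suc b) ≡ + 1 ℤ.* ((+ 1 ℤ.* + ℕ.suc a) ℤ.* + ℕ.suc b)
  lhs≡ = trans (ℤ.pos-* (ℕ.suc a) (ℕ.suc b)) (unitˡ (+ ℕ.suc a) (+ ℕ.suc b))
    where
    unitˡ : ∀ x y → x ℤ.* y ≡ + 1 ℤ.* ((+ 1 ℤ.* x) ℤ.* y)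
    unitˡ = solve-∀
  rhs≡ : + (q ℕ.* ℕ.suc m) ≡ ((+ q ℤ.* + 1) ℤ.* + 1) ℤ.* + ℕ.suc m
  rhs≡ = trans (ℤ.pos-* q (ℕ.suc m)) (unitʳ (+ q) (+ ℕ.suc m))
    where
    unitʳ : ∀ x y → x ℤ.* y ≡ ((x ℤ.* + 1) ℤ.* + 1) ℤ.* y
    unitʳ = solve-∀

module _ {q : ℕ} (G : FinAbGroup q) where
  open FinAbGroup G
  open IsAbelianGroup isAbelianGroup using (assoc; comm; identityˡ; inverseˡ; inverseʳ)

  abelianGroup : AbelianGroup _ _
  abelianGroup = record { isAbelianGroup = isAbelianGroup }

  open AbelianGroupProperties abelianGroup using (⁻¹-anti-homo‿-)
  open ≡-Reasoning

  [y-x]-[z-x]≡y-z : ∀ x y z → (y -ᴳ x) -ᴳ (z -ᴳ x) ≡ y -ᴳ z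
  [y-x]-[z-x]≡y-z x y z = begin
    (y +ᴳ -ᴳ x) +ᴳ -ᴳ (z +ᴳ -ᴳ x) ≡⟨ cong ((y +ᴳ -ᴳ x) +ᴳ_) (⁻¹-anti-homo‿- z x) ⟩
    (y +ᴳ -ᴳ x) +ᴳ (x +ᴳ -ᴳ z)    ≡⟨ assoc y (-ᴳ x) _ ⟩
    y +ᴳ (-ᴳ x +ᴳ (x +ᴳ -ᴳ z))    ≡⟨ cong (y +ᴳ_) (assoc (-ᴳ x) x _) ⟨
    y +ᴳ ((-ᴳ x +ᴳ x) +ᴳ -ᴳ z)    ≡⟨ cong (λ t → y +ᴳ (t +ᴳ -ᴳ z)) (inverseˡ x) ⟩
    y +ᴳ (0ᴳ +ᴳ -ᴳ z)             ≡⟨ cong (y +ᴳ_) (identityˡ _) ⟩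
    y +ᴳ -ᴳ z                     ∎

  y-[y-x]≡x : ∀ y x → y -ᴳ (y -ᴳ x) ≡ x
  y-[y-x]≡x y x = begin
    y +ᴳ -ᴳ (y +ᴳ -ᴳ x) ≡⟨ cong (y +ᴳ_) (⁻¹-anti-homo‿- y x) ⟩
    y +ᴳ (x +ᴳ -ᴳ y)    ≡⟨ cong (y +ᴳ_) (comm x (-ᴳ y)) ⟩
    y +ᴳ (-ᴳ y +ᴳ x)    ≡⟨ assoc y (-ᴳ y) x ⟨
    (y +ᴳ -ᴳ y) +ᴳ x    ≡⟨ cong (_+ᴳ x) (inverseʳ y) ⟩
    0ᴳ +ᴳ x             ≡⟨ identityˡ x ⟩
    x                   ∎

  Δ-positive : ∀ {A n} → 0ᴳ ∈ A → IsΔ G A n → 1 ℕ.≤ n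
  Δ-positive {A} 0∈A (_ , maximal) = subst (ℕ._≤ _) (∣⁅x⁆∣≡1 0ᴳ) (maximal ⁅ 0ᴳ ⁆ ⁅0⁆-⁅0⁆⊆A)
    where
    ⁅0⁆-⁅0⁆⊆A : DiffIn G ⁅ 0ᴳ ⁆ A
    ⁅0⁆-⁅0⁆⊆A x y x∈⁅0⁆ y∈⁅0⁆
      rewrite x∈⁅y⁆⇒x≡y 0ᴳ x∈⁅0⁆ | x∈⁅y⁆⇒x≡y 0ᴳ y∈⁅0⁆ | inverseʳ 0ᴳ = 0∈A

  infixr 7 _+ˢ_
  _+ˢ_ : Fin q → Subset q → Subset q
  x +ˢ B = tabulate (λ y → lookup B (y -ᴳ x))

  ∈-+ˢ⁻ : ∀ {x y} B → y ∈ x +ˢ B → (y -ᴳ x) ∈ B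
  ∈-+ˢ⁻ {x} {y} B y∈x+B =
    lookup⇒[]= (y -ᴳ x) B (trans (sym (lookup∘tabulate (λ z → lookup B (z -ᴳ x)) y)) ([]=⇒lookup y∈x+B))

  ∩-+ˢ-DiffIn : ∀ {A₁ A₂ B₁ B₂} → DiffIn G B₁ A₁ → DiffIn G B₂ A₂ →
    ∀ x → DiffIn G (B₁ ∩ x +ˢ B₂) (A₁ ∩ A₂)
  ∩-+ˢ-DiffIn {A₁} {A₂} {B₁} {B₂} B₁-B₁⊆A₁ B₂-B₂⊆A₂ x y z y∈C z∈C
    with x∈p∩q⁻ B₁ (x +ˢ B₂) y∈C | x∈p∩q⁻ B₁ (x +ˢ B₂) z∈C
  ... | y∈B₁ , y∈x+B₂ | z∈B₁ , z∈x+B₂ = x∈p∩q⁺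
    ( B₁-B₁⊆A₁ y z y∈B₁ z∈B₁
    , subst (_∈ A₂) ([y-x]-[z-x]≡y-z x y z) (B₂-B₂⊆A₂ _ _ (∈-+ˢ⁻ B₂ y∈x+B₂) (∈-+ˢ⁻ B₂ z∈x+B₂)))

  ∑∣B∩x+B′∣≡∣B∣*∣B′∣ : ∀ B B′ → sum (λ x → ∣ B ∩ x +ˢ B′ ∣) ≡ ∣ B ∣ ℕ.* ∣ B′ ∣
  ∑∣B∩x+B′∣≡∣B∣*∣B′∣ B B′ = begin
    sum (λ x → ∣ B ∩ x +ˢ B′ ∣)                    ≡⟨ sum-cong-≗ (λ x → ∣p∩q∣≡∑indicator* B (x +ˢ B′)) ⟩
    sum (λ x → sum (λ y → 𝟙B y ℕ.* 𝟙x+B′ x y))      ≡⟨ sum-cong-≗ (λ x → sum-cong-≗ (λ y →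
                                                         cong (λ b → 𝟙B y ℕ.* indicator b)
                                                           (lookup∘tabulate (λ z → lookup B′ (z -ᴳ x)) y))) ⟩
    sum (λ x → sum (λ y → 𝟙B y ℕ.* 𝟙B′ (y -ᴳ x)))  ≡⟨ ∑-comm (λ x y → 𝟙B y ℕ.* 𝟙B′ (y -ᴳ x)) ⟩
    sum (λ y → sum (λ x → 𝟙B y ℕ.* 𝟙B′ (y -ᴳ x)))  ≡⟨ sum-cong-≗ (λ y → *-distribˡ-sum (𝟙B y) (λ x → 𝟙B′ (y -ᴳ x))) ⟨
    sum (λ y → 𝟙B y ℕ.* sum (λ x → 𝟙B′ (y -ᴳ x)))  ≡⟨ sum-cong-≗ (λ y → cong (𝟙B y ℕ.*_) (∑-reflect y)) ⟨
    sum (λ y → 𝟙B y ℕ.* sum 𝟙B′)                   ≡⟨ *-distribʳ-sum (sum 𝟙B′) 𝟙B ⟨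
    sum 𝟙B ℕ.* sum 𝟙B′                             ≡⟨ cong₂ ℕ._*_ (∣p∣≡∑indicator B) (∣p∣≡∑indicator B′) ⟨
    ∣ B ∣ ℕ.* ∣ B′ ∣                                ∎
    where
    𝟙B 𝟙B′ : Fin q → ℕ
    𝟙B y = indicator (lookup B y)
    𝟙B′ y = indicator (lookup B′ y)
    𝟙x+B′ : Fin q → Fin q → ℕ
    𝟙x+B′ x y = indicator (lookup (x +ˢ B′) y)
    ∑-reflect : ∀ y → sum 𝟙B′ ≡ sum (λ x → 𝟙B′ (y -ᴳ x))
    ∑-reflect y = ∑-permute 𝟙B′ (permutation (λ x → y -ᴳ x) (λ x → y -ᴳ x) (y-[y-x]≡x y) (y-[y-x]≡x y))

  Δ-∩-bound : ∀ {A₁ A₂ n₁ n₂ n} → IsΔ G A₁ n₁ → IsΔ G A₂ n₂ → IsΔ G (A₁ ∩ A₂) n →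
    n₁ ℕ.* n₂ ℕ.≤ q ℕ.* n
  Δ-∩-bound ((B₁ , B₁-B₁⊆A₁ , refl) , _) ((B₂ , B₂-B₂⊆A₂ , refl) , _) (_ , maximal) =
    subst (ℕ._≤ _) (∑∣B∩x+B′∣≡∣B∣*∣B′∣ B₁ B₂)
      (sum-≤-* (λ x → ∣ B₁ ∩ x +ˢ B₂ ∣) _ (λ x → maximal _ (∩-+ˢ-DiffIn B₁-B₁⊆A₁ B₂-B₂⊆A₂ x)))

theorem6p1 : (q : ℕ) (G : FinAbGroup q) (A₁ A₂ : Subset q)
    → IsStandard G A₁ → IsStandard G A₂
    → (n₁ n₂ n : ℕ)
    → IsΔ G A₁ n₁ → IsΔ G A₂ n₂ → IsΔ G (A₁ ∩ A₂) n
    → recip n ≤ ((+ q / 1) * recip n₁) * recip n₂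
theorem6p1 q G A₁ A₂ (0∈A₁ , _) (0∈A₂ , _) n₁ n₂ n Δ₁ Δ₂ Δ =
  recip-≤-scaled q (Δ-positive G 0∈A₁ Δ₁) (Δ-positive G 0∈A₂ Δ₂)
    (Δ-positive G (x∈p∩q⁺ (0∈A₁ , 0∈A₂)) Δ) (Δ-∩-bound G Δ₁ Δ₂ Δ)
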